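{- Let $G$ be a digraph of order $n$. The location number of $G$ equals $n-1$ if and only if every vertex of $G$ is either universal or a sink.
   Context: For a digraph $G$ (loopless, no multiple arcs), a set $S$ of vertices is a locating set if every vertex not in $S$ has a distinct set of in-neighbours in $S$ (domination is not required). The location number of $G$ is the minimum size of a locating set of $G$; it is always at most $n-1$. A vertex is universal if it is an in-neighbour of all other vertices, and a sink if it has no out-neighbours. -}

module Defs where

open import Data.Nat using (ℕ; _≤_)
open import Data.Fin using (Fin)
open import Data.Bool using (Bool; true; false)
open import Data.Vec using (tabulate)
open import Data.Fin.Subset using (Subset; _∩_; _∉_; ∣_∣)
open import Data.Product using (Σ; _×_)
open import Relation.Binary.PropositionalEquality using (_≡_; _≢_)

record Digraph (n : ℕ) : Set where
  field
    arc      : Fin n → Fin n → Bool          -- arc u v ≡ true  iff  u → v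
    loopless : ∀ v → arc v v ≡ false
open Digraph public

module _ {n : ℕ} (G : Digraph n) where

  inNbhd : Fin n → Subset n
  inNbhd v = tabulate (λ u → arc G u v)

  -- S is locating: distinct vertices outside S have distinct sets of
  -- in-neighbours in S (domination not required)
  IsLocating : Subset n → Set
  IsLocating S = ∀ u v → u ∉ S → v ∉ S → u ≢ v →
                 (inNbhd u ∩ S) ≢ (inNbhd v ∩ S)

  IsLocationNumber : ℕ → Set
  IsLocationNumber k =
    Σ (Subset n) (λ S → IsLocating S × ∣ S ∣ ≡ k)
    × (∀ S → IsLocating S → k ≤ ∣ S ∣)

  Universal : Fin n → Set
  Universal v = ∀ u → u ≢ v → arc G v u ≡ true

  Sink : Fin n → Set
  Sink v = ∀ u → arc G v u ≡ false

{-# OPTIONS --safe #-}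
module Submission where

-- If every vertex is universal or a sink, two vertices u ≠ v outside S have the same
-- in-neighbours in S (a vertex of S is adjacent to both or to neither), so a locating set
-- misses at most one vertex; conversely, removing any one vertex always leaves a locating
-- set. If some v is neither, with v → a and v ↛ b for some b ≠ v, then v separates a and b,
-- so removing both a and b already leaves a locating set of size n - 2.

open import Defs
open import Data.Nat using (ℕ; zero; suc; _∸_; _+_; _≤_; _<_; z≤n)
open import Data.Nat.Properties
  using (≤-antisym; ≤-trans; <⇒≱; <⇒≤pred; +-comm; +-monoʳ-≤; m≤n+m∸n; m≤n+o⇒m∸n≤o;
         pred[m∸n]≡m∸[1+n]; module ≤-Reasoning)
open import Data.Bool using (true; false)
open import Data.Bool.Properties using (¬-not; not-¬) renaming (_≟_ to _≟ᵇ_)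
open import Data.Fin using (Fin; zero; _≟_)
open import Data.Fin.Properties using (all?; ¬∀⟶∃¬)
open import Data.Fin.Subset using (Subset; ⊤; ∁; _∩_; _-_; _∈_; _∉_; _⊆_; ∣_∣)
open import Data.Fin.Subset.Properties
  using (∈⊤; ∣⊤∣≡n; ∣⊥∣≡0; ∣⁅x⁆∣≡1; ∣∁p∣≡n∸∣p∣; x∈∁p⇒x∉p; x∉p⇒x∈∁p; x∈⁅y⁆⇔x≡y;
         x∈p∩q⁺; x∈p∩q⁻; x∈p∧x≢y⇒x∈p-y; x∈p⇒∣p-x∣<∣p∣; p⊆q⇒∣p∣≤∣q∣;
         ⊆-antisym; nonempty?; Empty-unique)
open import Data.Vec.Properties using (lookup∘tabulate; []=⇒lookup; lookup⇒[]=)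
open import Data.Product using (Σ; ∃₂; _×_; _,_; proj₁)
open import Data.Sum using (_⊎_; inj₁; inj₂; [_,_])
open import Function using (id)
open import Function.Bundles using (_⇔_; mk⇔; Equivalence)
open import Relation.Binary.PropositionalEquality using (_≡_; _≢_; refl; sym; trans; subst)
open import Relation.Nullary using (yes; no; contradiction)
open import Relation.Nullary.Decidable using (¬?; _→-dec_; decidable-stable)

Subsingleton : ∀ {n} → Subset n → Set
Subsingleton p = ∀ {x y} → x ∈ p → y ∈ p → x ≡ y

module _ {n : ℕ} where

  subsingleton⇒∣p∣≤1 : {p : Subset n} → Subsingleton p → ∣ p ∣ ≤ 1
  subsingleton⇒∣p∣≤1 {p} sub with nonempty? p
  ... | yes (x , x∈p) = subst (∣ p ∣ ≤_) (∣⁅x⁆∣≡1 x)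
                          (p⊆q⇒∣p∣≤∣q∣ (λ y∈p → Equivalence.from x∈⁅y⁆⇔x≡y (sub y∈p x∈p)))
  ... | no empty rewrite Empty-unique empty | ∣⊥∣≡0 n = z≤n

  subsingleton-∁⇒n∸1≤∣p∣ : {p : Subset n} → Subsingleton (∁ p) → n ∸ 1 ≤ ∣ p ∣
  subsingleton-∁⇒n∸1≤∣p∣ {p} sub = m≤n+o⇒m∸n≤o n 1 (begin
    n                  ≤⟨ m≤n+m∸n n ∣ p ∣ ⟩
    ∣ p ∣ + (n ∸ ∣ p ∣) ≤⟨ +-monoʳ-≤ ∣ p ∣ ∣∁p∣≤1 ⟩
    ∣ p ∣ + 1          ≡⟨ +-comm ∣ p ∣ 1 ⟩
    1 + ∣ p ∣          ∎)
    where
    open ≤-Reasoning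
    ∣∁p∣≤1 : n ∸ ∣ p ∣ ≤ 1
    ∣∁p∣≤1 = subst (_≤ 1) (∣∁p∣≡n∸∣p∣ p) (subsingleton⇒∣p∣≤1 sub)

  x∉p-y⇒x∉p⊎x≡y : {p : Subset n} {x y : Fin n} → x ∉ p - y → x ∉ p ⊎ x ≡ y
  x∉p-y⇒x∉p⊎x≡y {x = x} {y} x∉p-y with x ≟ y
  ... | yes x≡y = inj₂ x≡y
  ... | no x≢y  = inj₁ (λ x∈p → x∉p-y (x∈p∧x≢y⇒x∈p-y x∈p x≢y))

  x∉⊤-y⇒x≡y : {x y : Fin n} → x ∉ ⊤ - y → x ≡ y
  x∉⊤-y⇒x≡y x∉ = [ (λ x∉⊤ → contradiction ∈⊤ x∉⊤) , id ] (x∉p-y⇒x∉p⊎x≡y x∉)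

  x∉⊤-y-z⇒x≡y⊎x≡z : {x y z : Fin n} → x ∉ ⊤ - y - z → x ≡ y ⊎ x ≡ z
  x∉⊤-y-z⇒x≡y⊎x≡z x∉ = [ (λ x∉⊤-y → inj₁ (x∉⊤-y⇒x≡y x∉⊤-y)) , inj₂ ] (x∉p-y⇒x∉p⊎x≡y x∉)

  subsingleton-∁[⊤-x] : (x : Fin n) → Subsingleton (∁ (⊤ - x))
  subsingleton-∁[⊤-x] x y∈ z∈ = trans (x∉⊤-y⇒x≡y (x∈∁p⇒x∉p y∈)) (sym (x∉⊤-y⇒x≡y (x∈∁p⇒x∉p z∈)))

  x≢y∧x≢z⇒x∈⊤-y-z : {x y z : Fin n} → x ≢ y → x ≢ z → x ∈ ⊤ - y - z
  x≢y∧x≢z⇒x∈⊤-y-z x≢y x≢z = x∈p∧x≢y⇒x∈p-y (x∈p∧x≢y⇒x∈p-y ∈⊤ x≢y) x≢z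

  ∣⊤-x∣≤n∸1 : (x : Fin n) → ∣ ⊤ - x ∣ ≤ n ∸ 1
  ∣⊤-x∣≤n∸1 x = subst (∣ ⊤ - x ∣ ≤_) (pred[m∸n]≡m∸[1+n] n 0)
                  (<⇒≤pred (subst (∣ ⊤ - x ∣ <_) (∣⊤∣≡n n) (x∈p⇒∣p-x∣<∣p∣ {x = x} {p = ⊤} ∈⊤)))

  ∣⊤-x-y∣<n∸1 : {x y : Fin n} → y ≢ x → ∣ ⊤ - x - y ∣ < n ∸ 1
  ∣⊤-x-y∣<n∸1 {x} {y} y≢x = begin-strict
    ∣ ⊤ - x - y ∣ <⟨ x∈p⇒∣p-x∣<∣p∣ (x∈p∧x≢y⇒x∈p-y ∈⊤ y≢x) ⟩
    ∣ ⊤ - x ∣     ≤⟨ ∣⊤-x∣≤n∸1 x ⟩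
    n ∸ 1         ∎
    where open ≤-Reasoning

module _ {n : ℕ} (G : Digraph n) where

  ∈inNbhd⁺ : {u v : Fin n} → arc G u v ≡ true → u ∈ inNbhd G v
  ∈inNbhd⁺ {u} {v} uv = lookup⇒[]= u _ (trans (lookup∘tabulate (λ w → arc G w v) u) uv)

  ∈inNbhd⁻ : {u v : Fin n} → u ∈ inNbhd G v → arc G u v ≡ true
  ∈inNbhd⁻ {u} {v} u∈ = trans (sym (lookup∘tabulate (λ w → arc G w v) u)) ([]=⇒lookup u∈)

  inNbhd∩-cong : {S : Subset n} {u v : Fin n} → (∀ {w} → w ∈ S → arc G w u ≡ arc G w v) →
                 inNbhd G u ∩ S ≡ inNbhd G v ∩ S
  inNbhd∩-cong same = ⊆-antisym (transfer same) (transfer (λ w∈S → sym (same w∈S)))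
    where
    transfer : ∀ {S u v} → (∀ {w} → w ∈ S → arc G w u ≡ arc G w v) →
               inNbhd G u ∩ S ⊆ inNbhd G v ∩ S
    transfer same w∈ with x∈p∩q⁻ _ _ w∈
    ... | w∈N , w∈S = x∈p∩q⁺ (∈inNbhd⁺ (trans (sym (same w∈S)) (∈inNbhd⁻ w∈N)) , w∈S)

  inNbhd∩-separates : {S : Subset n} {u v w : Fin n} → w ∈ S →
                      arc G w u ≡ true → arc G w v ≡ false → inNbhd G u ∩ S ≢ inNbhd G v ∩ S
  inNbhd∩-separates {S} {w = w} w∈S wu wv eq =
    not-¬ wv (∈inNbhd⁻ (proj₁ (x∈p∩q⁻ _ S (subst (w ∈_) eq (x∈p∩q⁺ (∈inNbhd⁺ wu , w∈S))))))

  subsingleton-∁⇒locating : {S : Subset n} → Subsingleton (∁ S) → IsLocating G S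
  subsingleton-∁⇒locating sub u v u∉S v∉S u≢v _ = u≢v (sub (x∉p⇒x∈∁p u∉S) (x∉p⇒x∈∁p v∉S))

  universal⊎sink⇒arc≡ : {v a b : Fin n} → Universal G v ⊎ Sink G v → a ≢ v → b ≢ v →
                        arc G v a ≡ arc G v b
  universal⊎sink⇒arc≡ {a = a} {b} (inj₁ univ) a≢v b≢v = trans (univ a a≢v) (sym (univ b b≢v))
  universal⊎sink⇒arc≡ {a = a} {b} (inj₂ sink) _   _   = trans (sink a) (sym (sink b))

  locating⇒subsingleton-∁ : (∀ v → Universal G v ⊎ Sink G v) →
                            {S : Subset n} → IsLocating G S → Subsingleton (∁ S)
  locating⇒subsingleton-∁ H {S} loc {u} {v} u∈∁S v∈∁S = decidable-stable (u ≟ v) λ u≢v →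
    loc u v (x∈∁p⇒x∉p u∈∁S) (x∈∁p⇒x∉p v∈∁S) u≢v (inNbhd∩-cong λ {w} w∈S →
      universal⊎sink⇒arc≡ (H w) (outside w∈S u∈∁S) (outside w∈S v∈∁S))
    where
    outside : ∀ {x w} → w ∈ S → x ∈ ∁ S → x ≢ w
    outside w∈S x∈∁S refl = x∈∁p⇒x∉p x∈∁S w∈S

  Mixed : Fin n → Set
  Mixed v = ∃₂ λ a b → arc G v a ≡ true × arc G v b ≡ false × b ≢ v

  universal⊎sink⊎mixed : ∀ v → Universal G v ⊎ Sink G v ⊎ Mixed v
  universal⊎sink⊎mixed v with all? (λ u → arc G v u ≟ᵇ false)
  ... | yes sink = inj₂ (inj₁ sink)
  ... | no ¬sink with all? (λ u → ¬? (u ≟ v) →-dec arc G v u ≟ᵇ true)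
  ...   | yes univ = inj₁ univ
  ...   | no ¬univ with ¬∀⟶∃¬ n _ (λ u → arc G v u ≟ᵇ false) ¬sink
                      | ¬∀⟶∃¬ n _ (λ u → ¬? (u ≟ v) →-dec arc G v u ≟ᵇ true) ¬univ
  ...     | a , va≢false | b , ¬[b≢v→vb] =
    inj₂ (inj₂ (a , b , ¬-not va≢false , ¬-not (λ vb → ¬[b≢v→vb] λ _ → vb) ,
                λ b≡v → ¬[b≢v→vb] λ b≢v → contradiction b≡v b≢v))

  mixed⇒small-locating : {v : Fin n} → Mixed v →
                         Σ (Subset n) λ S → IsLocating G S × ∣ S ∣ < n ∸ 1
  mixed⇒small-locating {v} (a , b , va , vb , b≢v) = ⊤ - a - b , locating , ∣⊤-x-y∣<n∸1 b≢a
    where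
    v≢a : v ≢ a
    v≢a refl = not-¬ (loopless G v) va
    b≢a : b ≢ a
    b≢a refl = not-¬ vb va
    v∈S : v ∈ ⊤ - a - b
    v∈S = x≢y∧x≢z⇒x∈⊤-y-z v≢a (λ v≡b → b≢v (sym v≡b))
    locating : IsLocating G (⊤ - a - b)
    locating u w u∉ w∉ u≢w eq with x∉⊤-y-z⇒x≡y⊎x≡z u∉ | x∉⊤-y-z⇒x≡y⊎x≡z w∉
    ... | inj₁ refl | inj₁ refl = u≢w refl
    ... | inj₂ refl | inj₂ refl = u≢w refl
    ... | inj₁ refl | inj₂ refl = inNbhd∩-separates v∈S va vb eq
    ... | inj₂ refl | inj₁ refl = inNbhd∩-separates v∈S va vb (sym eq)

locating-≤n∸1 : ∀ {n} (G : Digraph n) → Σ (Subset n) λ S → IsLocating G S × ∣ S ∣ ≤ n ∸ 1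
locating-≤n∸1 {zero}  G = ⊤ , (λ ()) , z≤n
locating-≤n∸1 {suc n} G =
  ⊤ - zero , subsingleton-∁⇒locating G (subsingleton-∁[⊤-x] zero) , ∣⊤-x∣≤n∸1 zero

proposition4 : (n : ℕ) (G : Digraph n) (k : ℕ) → IsLocationNumber G k →
    (k ≡ n ∸ 1) ⇔ (∀ v → Universal G v ⊎ Sink G v)
proposition4 n G k ((S , S-locating , ∣S∣≡k) , k-minimal) = mk⇔ to from
  where
  to : k ≡ n ∸ 1 → ∀ v → Universal G v ⊎ Sink G v
  to k≡n∸1 v with universal⊎sink⊎mixed G v
  ... | inj₁ univ        = inj₁ univ
  ... | inj₂ (inj₁ sink) = inj₂ sink
  ... | inj₂ (inj₂ mixed) with mixed⇒small-locating G mixed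
  ...   | T , T-locating , ∣T∣<n∸1 =
    contradiction (subst (_≤ ∣ T ∣) k≡n∸1 (k-minimal T T-locating)) (<⇒≱ ∣T∣<n∸1)

  from : (∀ v → Universal G v ⊎ Sink G v) → k ≡ n ∸ 1
  from H with locating-≤n∸1 G
  ... | T , T-locating , ∣T∣≤n∸1 = ≤-antisym
    (≤-trans (k-minimal T T-locating) ∣T∣≤n∸1)
    (subst (n ∸ 1 ≤_) ∣S∣≡k (subsingleton-∁⇒n∸1≤∣p∣ (locating⇒subsingleton-∁ G H S-locating)))
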